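{- Let $b$ be a positive integer, $t\ge 0$ an integer, and $a=bt+1$. Then the regular configuration in $\mathrm{CONF}(a,b)$ is characterized by the sequence $\{t+1,t,\dots,t\}$ of length $b$.
   Context: $\mathrm{CONF}(a,b)$ is the set of necklaces (circular arrangements up to rotation) of $a$ red and $b$ black beads. A sequence $\{x_0,\dots,x_{b-1}\}$ of nonnegative integers with sum $a$ characterizes the necklace in which black beads $B_0,\dots,B_{b-1}$ appear in cyclic order with $x_i$ red beads between $B_i$ and $B_{i+1}$ (indices mod $b$). The necklace is regular if $\frac{a}{b}k-1<x_i+\dots+x_{i+k-1}<\frac{a}{b}k+1$ for all $0\le i\le b-1$ and $1\le k\le 1+\lfloor b/2\rfloor$ (indices mod $b$). There is a unique regular configuration in $\mathrm{CONF}(a,b)$. -}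

module Defs where

open import Data.Nat using (ℕ; zero; suc; _+_; _*_; _<_; _≤_; NonZero; _≡ᵇ_)
open import Data.Nat.DivMod using (_%_; _/_; m%n<n)
open import Data.Fin using (Fin; toℕ; fromℕ<)
open import Data.Bool using (if_then_else_)
open import Data.Product using (_×_; ∃-syntax)
open import Relation.Binary.PropositionalEquality using (_≡_)

-- A configuration in CONF(a,b) is described by a sequence x₀,…,x_{b-1}
-- (a function Fin b → ℕ): x_i red beads between black beads B_i, B_{i+1}.

cyc : (b : ℕ) .{{_ : NonZero b}} → (Fin b → ℕ) → ℕ → ℕ
cyc b x j = x (fromℕ< (m%n<n j b))

sumTo : (ℕ → ℕ) → ℕ → ℕ
sumTo f zero    = 0
sumTo f (suc k) = sumTo f k + f k

window : (b : ℕ) .{{_ : NonZero b}} → (Fin b → ℕ) → ℕ → ℕ → ℕ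
window b x i k = sumTo (λ j → cyc b x (i + j)) k

total : (b : ℕ) .{{_ : NonZero b}} → (Fin b → ℕ) → ℕ
total b x = window b x 0 b

InConf : (a b : ℕ) .{{_ : NonZero b}} → (Fin b → ℕ) → Set
InConf a b x = total b x ≡ a

-- Regularity: (a/b)k - 1 < S < (a/b)k + 1, multiplied through by b > 0:
--   a k < b S + b   and   b S < a k + b.
Regular : (a b : ℕ) .{{_ : NonZero b}} → (Fin b → ℕ) → Set
Regular a b x =
  InConf a b x ×
  (∀ i k → i < b → 1 ≤ k → k ≤ 1 + b / 2 →
     (a * k < b * window b x i k + b) × (b * window b x i k < a * k + b))

-- Two sequences describe the same necklace iff one is a cyclic rotation of the other.
SameNecklace : (b : ℕ) .{{_ : NonZero b}} → (Fin b → ℕ) → (Fin b → ℕ) → Set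
SameNecklace b x y = ∃[ r ] (∀ (i : Fin b) → y i ≡ cyc b x (toℕ i + r))

seqT : (b t : ℕ) → Fin b → ℕ
seqT b t i = if toℕ i ≡ᵇ 0 then suc t else t

module Submission where

-- Let a = bt + 1.  The proof has two halves, both organised around one
-- notion: a "spike" sequence, equal to t on [0, n) except at a single
-- place z, where it equals t + 1.
--
-- A sum of terms ≥ t over [0, n) is at least nt; if it equals nt
-- every term is t, and if it equals nt + 1 the sequence is a spike.
-- Conversely the partial sums of a spike over [0, k) are kt (k ≤ z) or
-- kt + 1 (z < k).
--
-- Every cyclic rotation of {t+1, t, …, t} is a spike: the
-- window starting at i meets the bead of size t+1 exactly at offset
-- (b - i) mod b, because j ↦ (i + j) mod b is injective on [0, b).  So
-- each window sum S of length k ≤ b is kt or kt + 1, and a short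
-- calculation shows that both values satisfy ak < bS + b and bS < ak + b.
--
-- Uniqueness.  The windows of length 1 force every x_i ≥ t; as the x_i sum
-- to bt + 1, x is a spike, and rotating it to start at the spike gives
-- {t+1, t, …, t}.

open import Defs
open import Data.Nat using (ℕ; zero; suc; _+_; _*_; _∸_; _<_; _≤_; z≤n; s≤s; NonZero; _/_; _%_; _≟_; _<?_)
open import Data.Nat.Properties
open import Data.Nat.DivMod using (m%n<n; m%n%n≡m%n; n%n≡0; [m+n]%n≡m%n; m<n⇒m%n≡m; %-distribˡ-+; m/n<m)
open import Data.Fin using (Fin; toℕ)
import Data.Fin as Fin
open import Data.Fin.Properties using (fromℕ<-cong; toℕ<n; toℕ-fromℕ<)
open import Data.Product using (_×_; _,_; proj₁; proj₂; ∃-syntax)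
open import Data.Sum using (_⊎_; inj₁; inj₂)
open import Data.Empty using (⊥-elim)
open import Relation.Nullary using (yes; no)
open import Relation.Binary.PropositionalEquality

+-tight : ∀ {a c d e} → c ≤ a → e ≤ d → a + d ≡ c + e → a ≡ c × d ≡ e
+-tight {a} {c} {d} {e} c≤a e≤d eq = a≡c , +-cancelˡ-≡ a d e (trans eq (cong (_+ e) (sym a≡c)))
  where
  a≡c : a ≡ c
  a≡c = ≤-antisym (+-cancelʳ-≤ d a c (subst (_≤ c + d) (sym eq) (+-monoʳ-≤ c e≤d))) c≤a

rescale : ∀ b t k → suc (b * t) * k ≡ k + b * (k * t)
rescale b t k = cong (k +_) (trans (*-assoc b t k) (cong (b *_) (*-comm t k)))

WindowBounds : ℕ → ℕ → ℕ → ℕ → Set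
WindowBounds a b k S = (a * k < b * S + b) × (b * S < a * k + b)

exact-window-regular : ∀ b t k → k < b → WindowBounds (suc (b * t)) b k (k * t)
exact-window-regular b t k k<b rewrite rescale b t k =
  subst (k + T <_) (+-comm b T) (+-monoˡ-< T k<b) ,
  ≤-<-trans (m≤n+m T k) (m<m+n (k + T) (≤-<-trans z≤n k<b))
  where T = b * (k * t)

excess-window-regular : ∀ b t k → 1 ≤ k → k ≤ b → WindowBounds (suc (b * t)) b k (suc (k * t))
excess-window-regular b t k 1≤k k≤b rewrite rescale b t k | *-suc b (k * t) =
  ≤-<-trans (+-monoˡ-≤ T k≤b) (m<m+n (b + T) (<-≤-trans 1≤k k≤b)) ,
  subst₂ _<_ (+-comm T b) (trans (+-comm (T + b) k) (sym (+-assoc k T b))) (m<m+n (T + b) 1≤k)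
  where T = b * (k * t)

unit-window-floor : ∀ b t w → suc (b * t) * 1 < b * w + b → t ≤ w
unit-window-floor b t w lt = ≤-pred (*-cancelˡ-< b t (suc w) bt<b[1+w])
  where
  bt<b[1+w] : b * t < b * suc w
  bt<b[1+w] = subst (b * t <_) (trans (+-comm (b * w) b) (sym (*-suc b w)))
                (<-trans (n<1+n (b * t)) (subst (_< b * w + b) (*-identityʳ (suc (b * t))) lt))

restrict : ∀ {n} {P : ℕ → Set} → (∀ j → j < suc n → P j) → ∀ j → j < n → P j
restrict h j j<n = h j (m<n⇒m<1+n j<n)

sum-lower : ∀ {t} f n → (∀ j → j < n → t ≤ f j) → n * t ≤ sumTo f n
sum-lower f zero    ge = z≤n
sum-lower {t} f (suc n) ge = subst (_≤ sumTo f n + f n) (+-comm (n * t) t)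
  (+-mono-≤ (sum-lower f n (restrict ge)) (ge n ≤-refl))

sum-const : ∀ {t} f n → (∀ j → j < n → f j ≡ t) → sumTo f n ≡ n * t
sum-const f zero    eq = refl
sum-const {t} f (suc n) eq =
  trans (cong₂ _+_ (sum-const f n (restrict eq)) (eq n ≤-refl)) (+-comm (n * t) t)

sum-tight : ∀ {t} f n → (∀ j → j < n → t ≤ f j) → sumTo f n ≡ n * t → ∀ j → j < n → f j ≡ t
sum-tight {t} f (suc n) ge eq j j<1+n
  with +-tight (sum-lower f n (restrict ge)) (ge n ≤-refl) (trans eq (+-comm t (n * t)))
... | init , last with m<1+n⇒m<n∨m≡n j<1+n
...   | inj₁ j<n  = sum-tight f n (restrict ge) init j j<n
...   | inj₂ refl = last

Spike : ℕ → ℕ → ℕ → (ℕ → ℕ) → Set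
Spike n t z f = f z ≡ suc t × (∀ j → j < n → j ≢ z → f j ≡ t)

spike-extend : ∀ {n t z f} → Spike n t z f → f n ≡ t → Spike (suc n) t z f
spike-extend {n} {t} {z} {f} (peak , flat) last = peak , rest
  where
  rest : ∀ j → j < suc n → j ≢ z → f j ≡ t
  rest j j<1+n j≢z with m<1+n⇒m<n∨m≡n j<1+n
  ... | inj₁ j<n  = flat j j<n j≢z
  ... | inj₂ refl = last

spike-at-end : ∀ {n t f} → (∀ j → j < n → f j ≡ t) → f n ≡ suc t → Spike (suc n) t n f
spike-at-end {n} {t} {f} flat peak = peak , rest
  where
  rest : ∀ j → j < suc n → j ≢ n → f j ≡ t
  rest j j<1+n j≢n with m<1+n⇒m<n∨m≡n j<1+n
  ... | inj₁ j<n = flat j j<n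
  ... | inj₂ j≡n = ⊥-elim (j≢n j≡n)

sum-one-excess : ∀ {t} f n → (∀ j → j < n → t ≤ f j) → sumTo f n ≡ suc (n * t) →
  ∃[ z ] z < n × Spike n t z f
sum-one-excess f zero ge ()
sum-one-excess {t} f (suc n) ge eq with f n ≟ t
... | yes last with sum-one-excess f n (restrict ge)
                     (+-cancelʳ-≡ t _ _ (trans (cong (sumTo f n +_) (sym last))
                                               (trans eq (cong suc (+-comm t (n * t))))))
...   | z , z<n , spike = z , m<n⇒m<1+n z<n , spike-extend spike last
sum-one-excess {t} f (suc n) ge eq | no last≢t =
  n , ≤-refl , spike-at-end (sum-tight f n (restrict ge) (proj₁ split)) (proj₂ split)
  where
  split : sumTo f n ≡ n * t × f n ≡ suc t
  split = +-tight (sum-lower f n (restrict ge)) (≤∧≢⇒< (ge n ≤-refl) (≢-sym last≢t))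
            (trans eq (trans (cong suc (+-comm t (n * t))) (sym (+-suc (n * t) t))))

sum-past-spike : ∀ {n t z f} → Spike n t z f → ∀ k → z < k → k ≤ n → sumTo f k ≡ suc (k * t)
sum-past-spike {t = t} {z} {f} (peak , flat) (suc k) z<1+k 1+k≤n with m<1+n⇒m<n∨m≡n z<1+k
... | inj₁ z<k  = trans (cong₂ _+_ (sum-past-spike (peak , flat) k z<k (<⇒≤ 1+k≤n))
                                   (flat k 1+k≤n (>⇒≢ z<k)))
                        (cong suc (+-comm (k * t) t))
... | inj₂ refl = trans (cong₂ _+_ (sum-const f z (λ j j<z → flat j (<-trans j<z 1+k≤n) (<⇒≢ j<z))) peak)
                        (trans (+-suc (z * t) t) (cong suc (+-comm (z * t) t)))

spike-window : ∀ {n t z f} → Spike n t z f → ∀ k → k ≤ n →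
  (k ≤ z × sumTo f k ≡ k * t) ⊎ (z < k × sumTo f k ≡ suc (k * t))
spike-window {t = t} {z} {f} spike k k≤n with z <? k
... | yes z<k = inj₂ (z<k , sum-past-spike spike k z<k k≤n)
... | no  z≮k = inj₁ (k≤z , sum-const f k flat-before)
  where
  k≤z : k ≤ z
  k≤z = ≮⇒≥ z≮k
  flat-before : ∀ j → j < k → f j ≡ t
  flat-before j j<k = proj₂ spike j (<-≤-trans j<k k≤n) (<⇒≢ (<-≤-trans j<k k≤z))

%-congʳ-+ : ∀ {b} .{{_ : NonZero b}} c {x y} → x % b ≡ y % b → (c + x) % b ≡ (c + y) % b
%-congʳ-+ {b} c {x} {y} eq = begin
  (c + x) % b           ≡⟨ %-distribˡ-+ c x b ⟩
  (c % b + x % b) % b   ≡⟨ cong (λ r → (c % b + r) % b) eq ⟩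
  (c % b + y % b) % b   ≡⟨ %-distribˡ-+ c y b ⟨
  (c + y) % b           ∎
  where open ≡-Reasoning

unshift : ∀ {b} .{{_ : NonZero b}} i j → i ≤ b → j < b → (b ∸ i + (i + j)) % b ≡ j
unshift {b} i j i≤b j<b = begin
  (b ∸ i + (i + j)) % b   ≡⟨ cong (_% b) (sym (+-assoc (b ∸ i) i j)) ⟩
  (b ∸ i + i + j) % b     ≡⟨ cong (λ m → (m + j) % b) (m∸n+n≡m i≤b) ⟩
  (b + j) % b             ≡⟨ cong (_% b) (+-comm b j) ⟩
  (j + b) % b             ≡⟨ [m+n]%n≡m%n j b ⟩
  j % b                   ≡⟨ m<n⇒m%n≡m j<b ⟩
  j                       ∎
  where open ≡-Reasoning

shift-injective : ∀ {b} .{{_ : NonZero b}} i {j j′} → i ≤ b → j < b → j′ < b →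
  (i + j) % b ≡ (i + j′) % b → j ≡ j′
shift-injective {b} i {j} {j′} i≤b j<b j′<b eq =
  trans (sym (unshift i j i≤b j<b)) (trans (%-congʳ-+ (b ∸ i) eq) (unshift i j′ i≤b j′<b))

complement : (b : ℕ) .{{_ : NonZero b}} → ℕ → ℕ
complement b i = (b ∸ i) % b

complement-hits : ∀ {b} .{{_ : NonZero b}} i → i ≤ b → (i + complement b i) % b ≡ 0
complement-hits {b} i i≤b =
  trans (%-congʳ-+ i (m%n%n≡m%n (b ∸ i) b)) (trans (cong (_% b) (m+[n∸m]≡n i≤b)) (n%n≡0 b))

cyc-mod : ∀ {b} .{{_ : NonZero b}} (x : Fin b → ℕ) n → cyc b x (n % b) ≡ cyc b x n
cyc-mod {b} x n = cong x (fromℕ<-cong _ _ (m%n%n≡m%n n b) _ _)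

seqT-cyc-zero : ∀ {b} .{{_ : NonZero b}} t n → n % b ≡ 0 → cyc b (seqT b t) n ≡ suc t
seqT-cyc-zero {b} t n n≡0 rewrite toℕ-fromℕ< (m%n<n n b) | n≡0 = refl

seqT-cyc-nonzero : ∀ {b} .{{_ : NonZero b}} t n → n % b ≢ 0 → cyc b (seqT b t) n ≡ t
seqT-cyc-nonzero {b} t n n≢0 rewrite toℕ-fromℕ< (m%n<n n b) with n % b
... | zero  = ⊥-elim (n≢0 refl)
... | suc _ = refl

seqT-rotated-spike : ∀ {b} .{{_ : NonZero b}} t i → i ≤ b →
  Spike b t (complement b i) (λ j → cyc b (seqT b t) (i + j))
seqT-rotated-spike {b} t i i≤b =
  seqT-cyc-zero t (i + o) (complement-hits i i≤b) ,
  λ j j<b j≢o → seqT-cyc-nonzero t (i + j) λ hit →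
    j≢o (shift-injective i i≤b j<b (m%n<n (b ∸ i) b) (trans hit (sym (complement-hits i i≤b))))
  where o = complement b i

window-length-bound : ∀ {b} .{{_ : NonZero b}} {k} → k ≤ 1 + b / 2 → k ≤ b
window-length-bound {b} k≤ = ≤-trans k≤ (m/n<m b 2 (s≤s (s≤s z≤n)))

seqT-regular : ∀ b t .{{_ : NonZero b}} → Regular (suc (b * t)) b (seqT b t)
seqT-regular b t = inConf , windows
  where
  inConf : total b (seqT b t) ≡ suc (b * t)
  inConf with spike-window (seqT-rotated-spike t 0 z≤n) b ≤-refl
  ... | inj₁ (b≤o , _) = ⊥-elim (<⇒≱ (m%n<n b b) b≤o)
  ... | inj₂ (_ , sum) = sum
  windows : ∀ i k → i < b → 1 ≤ k → k ≤ 1 + b / 2 → WindowBounds (suc (b * t)) b k (window b (seqT b t) i k)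
  windows i k i<b 1≤k k≤ with spike-window (seqT-rotated-spike t i (<⇒≤ i<b)) k (window-length-bound k≤)
  ... | inj₁ (k≤o , sum) = subst (WindowBounds (suc (b * t)) b k) (sym sum)
                             (exact-window-regular b t k (≤-<-trans k≤o (m%n<n (b ∸ i) b)))
  ... | inj₂ (_ , sum)   = subst (WindowBounds (suc (b * t)) b k) (sym sum)
                             (excess-window-regular b t k 1≤k (window-length-bound k≤))

regular-floor : ∀ b t .{{_ : NonZero b}} (x : Fin b → ℕ) → Regular (suc (b * t)) b x →
  ∀ j → j < b → t ≤ cyc b x j
regular-floor b t x (_ , windows) j j<b = subst (λ n → t ≤ cyc b x n) (+-identityʳ j)
  (unit-window-floor b t _ (proj₁ (windows j 1 j<b ≤-refl (s≤s z≤n))))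

spike-necklace : ∀ {b} .{{_ : NonZero b}} t (x : Fin b → ℕ) z → z < b →
  Spike b t z (cyc b x) → SameNecklace b x (seqT b t)
spike-necklace {b} t x z z<b (peak , flat) = z , rotated
  where
  rotated : ∀ i → seqT b t i ≡ cyc b x (toℕ i + z)
  rotated Fin.zero    = sym peak
  rotated (Fin.suc i) = sym (trans (sym (cyc-mod x m)) (flat (m % b) (m%n<n m b) off-spike))
    where
    m : ℕ
    m = suc (toℕ i) + z
    -- 0 < 1 + i < b, so shifting z by 1 + i cannot return to z.
    off-spike : m % b ≢ z
    off-spike hit = 1+n≢0 (shift-injective z (<⇒≤ z<b) (toℕ<n (Fin.suc i)) (≤-<-trans z≤n z<b) (begin
      (z + suc (toℕ i)) % b   ≡⟨ cong (_% b) (+-comm z (suc (toℕ i))) ⟩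
      m % b                   ≡⟨ hit ⟩
      z                       ≡⟨ m<n⇒m%n≡m z<b ⟨
      z % b                   ≡⟨ cong (_% b) (+-identityʳ z) ⟨
      (z + 0) % b             ∎))
      where open ≡-Reasoning

proposition3 : (b t : ℕ) .{{_ : NonZero b}} →
    Regular (suc (b * t)) b (seqT b t) ×
    (∀ (x : Fin b → ℕ) → Regular (suc (b * t)) b x → SameNecklace b x (seqT b t))
proposition3 b t = seqT-regular b t , unique
  where
  unique : ∀ (x : Fin b → ℕ) → Regular (suc (b * t)) b x → SameNecklace b x (seqT b t)
  unique x reg with sum-one-excess (cyc b x) b (regular-floor b t x reg) (proj₁ reg)
  ... | z , z<b , spike = spike-necklace t x z z<b spike
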